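{- Let $F$ be a graph, $\varepsilon>0$, and let $G$ be a graph that is uniformly $\varepsilon$-far from $F$-free, with corresponding $F$-partition $(V_i : i\in V(F))$. Then (i) $G$ is $\varepsilon/|F|$-far from $F$-free; (ii) for every $i\in V(F)$ and every neighbour $j$ of $i$ in $F$, every vertex of $V_i$ has at least $\varepsilon|G|$ neighbours in $V_j$; (iii) $|V_i|\ge \varepsilon|G|$ for every non-isolated vertex $i$ of $F$.
   Context: $|G|$ denotes the number of vertices of $G$. An $F$-partition of $G$ is a partition $(V_i : i\in V(F))$ of $V(G)$ into independent sets (some possibly empty) such that whenever $uv\in E(G)$ with $u\in V_i$, $v\in V_j$, we have $ij\in E(F)$. A graph $G$ is uniformly $\varepsilon$-far from $F$-free if it has an $F$-partition $(V_i: i\in V(F))$ and a collection $\mathcal{C}$ of pairwise edge-disjoint copies of $F$ in $G$ such that (a) in every copy in $\mathcal{C}$, for each $i\in V(F)$ the vertex corresponding to $i$ lies in $V_i$, and (b) every vertex of $G$ lies in at least $\varepsilon|G|$ copies from $\mathcal{C}$. An $n$-vertex graph is $\delta$-far from $F$-free if it cannot be made $F$-free by deleting fewer than $\delta n^2$ edges.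
   Formalization: The parameter ε ranges over the positive rationals, as does the parameter δ in the definition of δ-far from F-free. -}

module Defs where

open import Data.Nat as ℕ using (ℕ; NonZero)
open import Data.Fin using (Fin; _<_)
open import Data.Fin.Properties using (any?; _≟_)
open import Data.Bool using (Bool; true; false; T; not; _∧_)
open import Data.List using (List; length; filter; allFin; lookup; concatMap; map)
open import Data.Product using (Σ; ∃; _×_; _,_)
open import Data.Integer using (+_)
open import Data.Rational using (ℚ; _/_)
open import Relation.Binary.PropositionalEquality using (_≡_; _≢_)
open import Relation.Nullary using (¬_; Dec)
open import Relation.Nullary.Decidable using (⌊_⌋)
open import Function.Definitions using (Injective)

record Graph (n : ℕ) : Set where
  field
    adj   : Fin n → Fin n → Bool
    sym   : ∀ u v → adj u v ≡ adj v u
    irrefl : ∀ v → adj v v ≡ false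
open Graph public

Edge : ∀ {n} → Graph n → Fin n → Fin n → Set
Edge G u v = T (adj G u v)

⟦_⟧ : ℕ → ℚ
⟦ m ⟧ = + m / 1

count : ∀ {n} {P : Fin n → Set} → (∀ x → Dec (P x)) → ℕ
count {n} P? = length (filter P? (allFin n))

record Copy {k n : ℕ} (F : Graph k) (G : Graph n) : Set where
  field
    emb  : Fin k → Fin n
    inj  : Injective _≡_ _≡_ emb
    hom  : ∀ i j → Edge F i j → Edge G (emb i) (emb j)
open Copy public

FFree : ∀ {k n} → Graph k → Graph n → Set
FFree F G = ¬ Copy F G

EdgeDisjoint : ∀ {k n} {F : Graph k} {G : Graph n} → Copy F G → Copy F G → Set
EdgeDisjoint {F = F} c d =
  ∀ i j i' j' → Edge F i j → Edge F i' j' →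
    ¬ (emb c i ≡ emb d i' × emb c j ≡ emb d j')

InCopy : ∀ {k n} {F : Graph k} {G : Graph n} → Copy F G → Fin n → Set
InCopy c v = ∃ λ i → emb c i ≡ v

inCopy? : ∀ {k n} {F : Graph k} {G : Graph n} (v : Fin n) (c : Copy F G) → Dec (InCopy c v)
inCopy? v c = any? (λ i → emb c i ≟ v)

copiesAt : ∀ {k n} {F : Graph k} {G : Graph n} → List (Copy F G) → Fin n → ℕ
copiesAt C v = length (filter (inCopy? v) C)

-- An F-partition of G, given as the map sending each vertex v to the index i with v ∈ V_i.
record FPartition {k n : ℕ} (F : Graph k) (G : Graph n) : Set where
  field
    part        : Fin n → Fin k
    independent : ∀ u v → Edge G u v → part u ≢ part v
    respects    : ∀ u v → Edge G u v → Edge F (part u) (part v)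
open FPartition public

partSize : ∀ {k n} {F : Graph k} {G : Graph n} → FPartition F G → Fin k → ℕ
partSize P i = count (λ v → part P v ≟ i)

degInto : ∀ {k n} {F : Graph k} {G : Graph n} → FPartition F G → Fin n → Fin k → ℕ
degInto {G = G} P v j =
  count (λ w → Data.Bool._≟_ (adj G v w ∧ ⌊ part P w ≟ j ⌋) true)

UniformlyFarWith : ∀ {k n} (F : Graph k) (G : Graph n) → ℚ → FPartition F G → Set
UniformlyFarWith {k} {n} F G ε P =
  Σ (List (Copy F G)) λ C →
      (∀ (a b : Fin (length C)) → a ≢ b → EdgeDisjoint (lookup C a) (lookup C b))
    × (∀ c → Data.List.Membership.Propositional._∈_ c C → ∀ i → part P (emb c i) ≡ i)
    × (∀ v → Data.Rational._≤_ (ε Data.Rational.* ⟦ n ⟧) ⟦ copiesAt C v ⟧)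
  where import Data.List.Membership.Propositional
        import Data.Rational

UniformlyFar : ∀ {k n} (F : Graph k) (G : Graph n) → ℚ → Set
UniformlyFar F G ε = Σ (FPartition F G) (UniformlyFarWith F G ε)

_⊆ᴱ_ : ∀ {n} → Graph n → Graph n → Set
H ⊆ᴱ G = ∀ u v → Edge H u v → Edge G u v

-- number of edges of G not in H (unordered pairs, counted once via u < v)
deleted : ∀ {n} → Graph n → Graph n → ℕ
deleted {n} G H =
  length (filter (λ p → Data.Bool._≟_ (⌊ Data.Product.proj₁ p Data.Fin.<? Data.Product.proj₂ p ⌋
                                        ∧ adj G (Data.Product.proj₁ p) (Data.Product.proj₂ p)
                                        ∧ not (adj H (Data.Product.proj₁ p) (Data.Product.proj₂ p))) true)
                 (Data.List.cartesianProduct (allFin n) (allFin n)))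
  where import Data.Product
        import Data.Fin
        import Data.List

Far : ∀ {k n} (F : Graph k) (G : Graph n) → ℚ → Set
Far {n = n} F G δ =
  ∀ (H : Graph n) → H ⊆ᴱ G →
    Data.Rational._<_ ⟦ deleted G H ⟧ (δ Data.Rational.* ⟦ n ℕ.* n ⟧) → ¬ FFree F H
  where import Data.Rational

-- (i) Turning G into an F-free graph H destroys every copy of F in the edge-disjoint family C, and
-- the edge a copy loses is lost by no other copy, so at least |C| edges are deleted. Double counting
-- vertex-copy incidences gives εn·n ≤ Σ_v #(copies through v) ≤ |C|·|F|, hence |C| ≥ (ε/|F|)n².
-- (ii) A copy through v ∈ V_i uses v as its i-vertex, so its j-vertex is a neighbour of v in V_j;
-- these neighbours are distinct, since two copies sharing one would share the edge it spans with v.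
-- (iii) Some copy exists, and its j-vertex has at least εn neighbours in V_i.
module Submission where

open import Defs
open import Data.Nat using (ℕ; NonZero)
open import Data.Integer using (+_)
open import Data.Rational using (ℚ; 0ℚ; _<_; _≤_; _*_; _/_)
open import Data.Product using (_×_; ∃)
open import Relation.Binary.PropositionalEquality using (_≡_)

open import Data.Bool using (true; false; T; not; _∧_)
import Data.Bool as Bool
open import Data.Bool.Properties using (T?; T-≡; T-∧)
open import Data.Empty using (⊥-elim)
open import Data.Fin using (Fin; zero; suc; _<?_) renaming (_<_ to _<ᶠ_)
open import Data.Fin.Properties using (suc-injective; <-cmp; any?; _≟_)
import Data.Integer as ℤ
import Data.Integer.Properties as ℤ
open import Data.List using (List; []; _∷_; length; map; filter; lookup; allFin; cartesianProduct)
open import Data.List.Membership.Propositional using (_∈_)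
open import Data.List.Membership.Propositional.Properties
  using (∈-map⁺; ∈-map⁻; ∈-filter⁺; ∈-filter⁻; ∈-allFin; ∈-cartesianProduct⁺)
open import Data.List.Properties using (length-map; length-removeAt′; length-tabulate)
open import Data.List.Relation.Binary.Subset.Propositional using (_⊆_)
open import Data.List.Relation.Unary.All as All using (All; []; _∷_)
open import Data.List.Relation.Unary.AllPairs as AllPairs using (AllPairs; []; _∷_)
import Data.List.Relation.Unary.AllPairs.Properties as AllPairsₚ
open import Data.List.Relation.Unary.Any using (here; there; index; _─_)
open import Data.List.Relation.Unary.Any.Properties using (lookup-index)
open import Data.List.Relation.Unary.Unique.Propositional using (Unique)
import Data.List.Relation.Unary.Unique.Propositional.Properties as Unique
import Data.Nat as ℕ
open import Data.Nat.Coprimality as Coprime using (1-coprimeTo)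
open import Data.Nat.ListAction using (sum)
import Data.Nat.Properties as ℕ
open import Algebra.Properties.CommutativeSemigroup ℕ.+-commutativeSemigroup using (x∙yz≈y∙xz)
open import Data.Product using (_,_; ∃₂; proj₁; proj₂)
open import Data.Rational using (1ℚ; mkℚ; _+_; *≤*)
import Data.Rational.Properties as ℚ
open import Data.Rational.Solver using (module +-*-Solver)
open import Function using (id; _∘_; case_of_)
open import Function.Bundles using (Equivalence)
open import Relation.Binary.Definitions using (tri<; tri≈; tri>)
open import Relation.Binary.PropositionalEquality using (_≢_; refl; cong; cong₂; subst; subst₂; trans)
import Relation.Binary.PropositionalEquality as ≡
open import Relation.Nullary using (Dec; yes; no; ¬_; ¬?; _×-dec_)
open import Relation.Nullary.Decidable using (⌊_⌋; fromWitness; toWitness; decidable-stable)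

⟦⟧-mkℚ : ∀ m → ⟦ m ⟧ ≡ mkℚ (+ m) 0 (Coprime.sym (1-coprimeTo m))
⟦⟧-mkℚ m = ℚ.normalize-coprime (Coprime.sym (1-coprimeTo m))

⟦⟧-mono-≤ : ∀ {m n} → m ℕ.≤ n → ⟦ m ⟧ ≤ ⟦ n ⟧
⟦⟧-mono-≤ {m} {n} m≤n rewrite ⟦⟧-mkℚ m | ⟦⟧-mkℚ n =
  *≤* (subst₂ ℤ._≤_ (≡.sym (ℤ.*-identityʳ (+ m))) (≡.sym (ℤ.*-identityʳ (+ n))) (ℤ.+≤+ m≤n))

⟦⟧-+ : ∀ m n → ⟦ m ℕ.+ n ⟧ ≡ ⟦ m ⟧ + ⟦ n ⟧
⟦⟧-+ m n rewrite ⟦⟧-mkℚ m | ⟦⟧-mkℚ n =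
  cong (_/ 1) (≡.sym (cong₂ ℤ._+_ (ℤ.*-identityʳ (+ m)) (ℤ.*-identityʳ (+ n))))

⟦⟧-* : ∀ m n → ⟦ m ℕ.* n ⟧ ≡ ⟦ m ⟧ * ⟦ n ⟧
⟦⟧-* m n rewrite ⟦⟧-mkℚ m | ⟦⟧-mkℚ n = cong (_/ 1) (≡.sym (ℤ.+◃n≡+n (m ℕ.* n)))

⟦⟧-*-inverse : ∀ k .{{_ : NonZero k}} → ⟦ k ⟧ * (+ 1 / k) ≡ 1ℚ
⟦⟧-*-inverse (ℕ.suc k) rewrite ⟦⟧-mkℚ (ℕ.suc k) | ℚ.normalize-coprime {1} {k} (1-coprimeTo (ℕ.suc k)) =
  ℚ.*-inverseʳ (mkℚ (+ ℕ.suc k) 0 (Coprime.sym (1-coprimeTo (ℕ.suc k))))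

x≤⟦c*k⟧⇒x/k≤⟦c⟧ : ∀ {x : ℚ} c k .{{_ : NonZero k}} → x ≤ ⟦ c ℕ.* k ⟧ → x * (+ 1 / k) ≤ ⟦ c ⟧
x≤⟦c*k⟧⇒x/k≤⟦c⟧ {x} c k x≤ck = begin
  x * (+ 1 / k)                  ≤⟨ ℚ.*-monoʳ-≤-nonNeg (+ 1 / k) {{ℚ.normalize-nonNeg 1 k}} x≤ck ⟩
  ⟦ c ℕ.* k ⟧ * (+ 1 / k)        ≡⟨ cong (_* (+ 1 / k)) (⟦⟧-* c k) ⟩
  ⟦ c ⟧ * ⟦ k ⟧ * (+ 1 / k)      ≡⟨ ℚ.*-assoc ⟦ c ⟧ ⟦ k ⟧ (+ 1 / k) ⟩
  ⟦ c ⟧ * (⟦ k ⟧ * (+ 1 / k))    ≡⟨ cong (⟦ c ⟧ *_) (⟦⟧-*-inverse k) ⟩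
  ⟦ c ⟧ * 1ℚ                     ≡⟨ ℚ.*-identityʳ ⟦ c ⟧ ⟩
  ⟦ c ⟧                          ∎
  where open ℚ.≤-Reasoning

length*≤sum : ∀ {A : Set} {q : ℚ} (g : A → ℕ) → (∀ x → q ≤ ⟦ g x ⟧) →
              ∀ xs → ⟦ length xs ⟧ * q ≤ ⟦ sum (map g xs) ⟧
length*≤sum {q = q} g q≤g [] = ℚ.≤-reflexive (ℚ.*-zeroˡ q)
length*≤sum {q = q} g q≤g (x ∷ xs) = begin
  ⟦ 1 ℕ.+ length xs ⟧ * q          ≡⟨ cong (_* q) (⟦⟧-+ 1 (length xs)) ⟩
  (1ℚ + ⟦ length xs ⟧) * q         ≡⟨ ℚ.*-distribʳ-+ q 1ℚ ⟦ length xs ⟧ ⟩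
  1ℚ * q + ⟦ length xs ⟧ * q       ≡⟨ cong (_+ ⟦ length xs ⟧ * q) (ℚ.*-identityˡ q) ⟩
  q + ⟦ length xs ⟧ * q            ≤⟨ ℚ.+-mono-≤ (q≤g x) (length*≤sum g q≤g xs) ⟩
  ⟦ g x ⟧ + ⟦ sum (map g xs) ⟧     ≡⟨ ⟦⟧-+ (g x) (sum (map g xs)) ⟨
  ⟦ g x ℕ.+ sum (map g xs) ⟧       ∎
  where open ℚ.≤-Reasoning

module _ {A : Set} where

  ∈-─⁺ : ∀ {x y : A} {xs} (x∈xs : x ∈ xs) → y ∈ xs → y ≢ x → y ∈ (xs ─ x∈xs)
  ∈-─⁺ (here refl) (here refl) y≢x = ⊥-elim (y≢x refl)
  ∈-─⁺ (here _)    (there y∈)  _   = y∈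
  ∈-─⁺ (there _)   (here refl) _   = here refl
  ∈-─⁺ (there x∈)  (there y∈)  y≢x = there (∈-─⁺ x∈ y∈ y≢x)

  Unique-⊆⇒length-≤ : ∀ {xs ys : List A} → Unique xs → xs ⊆ ys → length xs ℕ.≤ length ys
  Unique-⊆⇒length-≤ []                 _     = ℕ.z≤n
  Unique-⊆⇒length-≤ {ys = ys} (x∉xs ∷ xs!) xs⊆ys
    rewrite length-removeAt′ ys (index (xs⊆ys (here refl))) =
    ℕ.s≤s (Unique-⊆⇒length-≤ xs! λ y∈ →
      ∈-─⁺ (xs⊆ys (here refl)) (xs⊆ys (there y∈)) (All.lookup x∉xs y∈ ∘ ≡.sym))

  allPairs-lookup⁺ : ∀ {R : A → A → Set} (xs : List A) →
                     (∀ a b → a ≢ b → R (lookup xs a) (lookup xs b)) → AllPairs R xs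
  allPairs-lookup⁺ []       _    = []
  allPairs-lookup⁺ {R} (x ∷ xs) R-at =
    All.tabulate (λ y∈ → subst (R x) (≡.sym (lookup-index y∈)) (R-at zero (suc (index y∈)) λ ())) ∷
    allPairs-lookup⁺ xs (λ a b a≢b → R-at (suc a) (suc b) (a≢b ∘ suc-injective))

  allPairs-mapWith-All : ∀ {P : A → Set} {R S : A → A → Set} →
                         (∀ {x y} → P x → P y → R x y → S x y) →
                         ∀ {xs} → All P xs → AllPairs R xs → AllPairs S xs
  allPairs-mapWith-All f []         []          = []
  allPairs-mapWith-All f (px ∷ pxs) (rxs ∷ rxss) =
    All.zipWith (λ (py , r) → f px py r) (pxs , rxs) ∷ allPairs-mapWith-All f pxs rxss

module _ {A B : Set} where

  injection⇒length-≤ : ∀ (f : A → B) {xs : List A} {ys : List B} →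
                       AllPairs (λ x y → f x ≢ f y) xs → (∀ {x} → x ∈ xs → f x ∈ ys) →
                       length xs ℕ.≤ length ys
  injection⇒length-≤ f {xs} {ys} f-inj f∈ys = subst (ℕ._≤ length ys) (length-map f xs)
    (Unique-⊆⇒length-≤ (AllPairsₚ.map⁺ f-inj)
      (λ fx∈ → case ∈-map⁻ f fx∈ of λ { (x , x∈ , refl) → f∈ys x∈ }))

module _ {A B : Set} {R : A → B → Set} (R? : ∀ a b → Dec (R a b)) where

  degree : List B → A → ℕ
  degree bs a = length (filter (R? a) bs)

  codegree : List A → B → ℕ
  codegree as b = length (filter (λ a → R? a b) as)

  sum-degree-[] : ∀ as → sum (map (degree []) as) ≡ 0
  sum-degree-[] []       = refl
  sum-degree-[] (_ ∷ as) = sum-degree-[] as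

  sum-degree-∷ : ∀ b bs as → sum (map (degree (b ∷ bs)) as) ≡ codegree as b ℕ.+ sum (map (degree bs) as)
  sum-degree-∷ b bs []       = refl
  sum-degree-∷ b bs (a ∷ as) with R? a b
  ... | yes _ = cong ℕ.suc (trans (cong (degree bs a ℕ.+_) (sum-degree-∷ b bs as))
                                  (x∙yz≈y∙xz (degree bs a) (codegree as b) _))
  ... | no  _ = trans (cong (degree bs a ℕ.+_) (sum-degree-∷ b bs as))
                      (x∙yz≈y∙xz (degree bs a) (codegree as b) _)

  sum-degree-≤ : ∀ {m} as → (∀ b → codegree as b ℕ.≤ m) → ∀ bs → sum (map (degree bs) as) ℕ.≤ length bs ℕ.* m
  sum-degree-≤ as codeg≤m []       = ℕ.≤-reflexive (sum-degree-[] as)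
  sum-degree-≤ as codeg≤m (b ∷ bs) rewrite sum-degree-∷ b bs as =
    ℕ.+-mono-≤ (codeg≤m b) (sum-degree-≤ as codeg≤m bs)

Edge-sym : ∀ {n} (G : Graph n) {u v} → Edge G u v → Edge G v u
Edge-sym G {u} {v} = subst T (Graph.sym G u v)

Edge-irrefl : ∀ {n} (G : Graph n) {v} → ¬ Edge G v v
Edge-irrefl G {v} = subst T (Graph.irrefl G v)

¬T⇒T-not : ∀ {b} → ¬ T b → T (not b)
¬T⇒T-not {false} _  = _
¬T⇒T-not {true}  ¬t = ⊥-elim (¬t _)

T⇒≡true : ∀ {b} → T b → b ≡ true
T⇒≡true = Equivalence.to T-≡

T-∧-intro : ∀ {a b} → T a → T b → T (a ∧ b)
T-∧-intro ta tb = Equivalence.from T-∧ (ta , tb)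

module _ {k n : ℕ} {F : Graph k} {G : Graph n} where

  vertices≤order : ∀ (c : Copy F G) → codegree inCopy? (allFin n) c ℕ.≤ k
  vertices≤order c = subst (codegree inCopy? (allFin n) c ℕ.≤_)
    (trans (length-map (emb c) (allFin k)) (length-tabulate _))
    (Unique-⊆⇒length-≤ (Unique.filter⁺ _ (Unique.allFin⁺ n)) emb-onto)
    where
    emb-onto : filter (λ v → inCopy? v c) (allFin n) ⊆ map (emb c) (allFin k)
    emb-onto v∈ with ∈-filter⁻ (λ v → inCopy? v c) {xs = allFin n} v∈
    ... | _ , i , refl = ∈-map⁺ (emb c) (∈-allFin i)

  sum-copiesAt≤ : ∀ (C : List (Copy F G)) → sum (map (copiesAt C) (allFin n)) ℕ.≤ length C ℕ.* k
  sum-copiesAt≤ = sum-degree-≤ inCopy? (allFin n) vertices≤order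

module _ {k n : ℕ} {F : Graph k} {G H : Graph n} (H-free : FFree F H) where

  missingEdge : (c : Copy F G) → ∃₂ λ i j → Edge F i j × ¬ Edge H (emb c i) (emb c j)
  missingEdge c with any? (λ i → any? (λ j → T? (adj F i j) ×-dec ¬? (T? (adj H (emb c i) (emb c j)))))
  ... | yes (i , j , e , ¬h) = i , j , e , ¬h
  ... | no none = ⊥-elim (H-free record
    { emb = emb c
    ; inj = inj c
    ; hom = λ i j e → decidable-stable (T? _) λ ¬h → none (i , j , e , ¬h)
    })

  orientedMissingEdge : (c : Copy F G) →
    ∃₂ λ i j → Edge F i j × ¬ Edge H (emb c i) (emb c j) × emb c i <ᶠ emb c j
  orientedMissingEdge c with missingEdge c
  ... | i , j , e , ¬h with <-cmp (emb c i) (emb c j)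
  ... | tri< lt _ _ = i , j , e , ¬h , lt
  ... | tri≈ _ eq _ = ⊥-elim (Edge-irrefl F (subst (λ i → Edge F i j) (inj c eq) e))
  ... | tri> _ _ gt = j , i , Edge-sym F e , ¬h ∘ Edge-sym H , gt

  -- Spelled exactly as in `deleted`, so that its length is `deleted G H` by definition; this is
  -- also why the missing edge is oriented, as only pairs u < w are listed.
  deletedPairs : List (Fin n × Fin n)
  deletedPairs = filter (λ p → Bool._≟_ (⌊ proj₁ p <? proj₂ p ⌋ ∧ adj G (proj₁ p) (proj₂ p)
                                          ∧ not (adj H (proj₁ p) (proj₂ p))) true)
                        (cartesianProduct (allFin n) (allFin n))

  ∈-deletedPairs⁺ : ∀ {u w} → u <ᶠ w → Edge G u w → ¬ Edge H u w → (u , w) ∈ deletedPairs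
  ∈-deletedPairs⁺ {u} {w} u<w g ¬h = ∈-filter⁺ _ (∈-cartesianProduct⁺ (∈-allFin u) (∈-allFin w))
    (T⇒≡true (T-∧-intro (fromWitness {a? = u <? w} u<w) (T-∧-intro g (¬T⇒T-not ¬h))))

  deletedPair : Copy F G → Fin n × Fin n
  deletedPair c = let i , j , _ = orientedMissingEdge c in emb c i , emb c j

  edgeDisjoint-copies≤deleted : ∀ {C} → AllPairs EdgeDisjoint C → length C ℕ.≤ deleted G H
  edgeDisjoint-copies≤deleted disjoint = injection⇒length-≤ deletedPair
    (AllPairs.map (λ {c} {d} → distinct c d) disjoint)
    (λ {c} _ → let _ , _ , e , ¬h , lt = orientedMissingEdge c in ∈-deletedPairs⁺ lt (hom c _ _ e) ¬h)
    where
    distinct : ∀ c d → EdgeDisjoint c d → deletedPair c ≢ deletedPair d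
    distinct c d c⊥d eq =
      let i  , j  , e  , _ = orientedMissingEdge c
          i' , j' , e' , _ = orientedMissingEdge d
      in c⊥d i j i' j' e e' (cong proj₁ eq , cong proj₂ eq)

module _ {k n : ℕ} {F : Graph k} {G : Graph n} .{{_ : NonZero k}} where

  copiesAt-≥⇒length-≥ : ∀ {ε} (C : List (Copy F G)) → (∀ v → ε * ⟦ n ⟧ ≤ ⟦ copiesAt C v ⟧) →
                        ε * (+ 1 / k) * ⟦ n ℕ.* n ⟧ ≤ ⟦ length C ⟧
  copiesAt-≥⇒length-≥ {ε} C covered = begin
    ε * (+ 1 / k) * ⟦ n ℕ.* n ⟧          ≡⟨ rearrange ⟩
    ⟦ n ⟧ * (ε * ⟦ n ⟧) * (+ 1 / k)      ≤⟨ x≤⟦c*k⟧⇒x/k≤⟦c⟧ (length C) k (begin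
      ⟦ n ⟧ * (ε * ⟦ n ⟧)                  ≡⟨ cong (λ m → ⟦ m ⟧ * (ε * ⟦ n ⟧)) (length-tabulate {n = n} id) ⟨
      ⟦ length (allFin n) ⟧ * (ε * ⟦ n ⟧)  ≤⟨ length*≤sum (copiesAt C) covered (allFin n) ⟩
      ⟦ sum (map (copiesAt C) (allFin n)) ⟧ ≤⟨ ⟦⟧-mono-≤ (sum-copiesAt≤ C) ⟩
      ⟦ length C ℕ.* k ⟧                   ∎) ⟩
    ⟦ length C ⟧                         ∎
    where
    open ℚ.≤-Reasoning
    open +-*-Solver using (solve; _:*_; _:=_)
    rearrange : ε * (+ 1 / k) * ⟦ n ℕ.* n ⟧ ≡ ⟦ n ⟧ * (ε * ⟦ n ⟧) * (+ 1 / k)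
    rearrange rewrite ⟦⟧-* n n =
      solve 3 (λ e t x → e :* t :* (x :* x) := x :* (e :* x) :* t) refl ε (+ 1 / k) ⟦ n ⟧

  edgeDisjoint-cover⇒far : ∀ {ε} {C : List (Copy F G)} → AllPairs EdgeDisjoint C →
                           (∀ v → ε * ⟦ n ⟧ ≤ ⟦ copiesAt C v ⟧) → Far F G (ε * (+ 1 / k))
  edgeDisjoint-cover⇒far {ε} {C} disjoint covered H _ deleted<bound H-free =
    ℚ.<-irrefl refl (ℚ.<-≤-trans deleted<bound (ℚ.≤-trans (copiesAt-≥⇒length-≥ {ε} C covered)
      (⟦⟧-mono-≤ (edgeDisjoint-copies≤deleted H-free disjoint))))

module _ {k n : ℕ} {F : Graph k} {G : Graph n} (P : FPartition F G) where

  neighboursIn : Fin n → Fin k → List (Fin n)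
  neighboursIn v j = filter (λ w → Bool._≟_ (adj G v w ∧ ⌊ part P w ≟ j ⌋) true) (allFin n)

  ∈-neighboursIn⁺ : ∀ {v w j} → Edge G v w → part P w ≡ j → w ∈ neighboursIn v j
  ∈-neighboursIn⁺ {v} {w} {j} vw pw≡j =
    ∈-filter⁺ _ (∈-allFin w) (T⇒≡true (T-∧-intro vw (fromWitness {a? = part P w ≟ j} pw≡j)))

  ∈-neighboursIn⁻ : ∀ {v w j} → w ∈ neighboursIn v j → part P w ≡ j
  ∈-neighboursIn⁻ {v} {w} {j} w∈ =
    toWitness {a? = part P w ≟ j}
      (proj₂ (Equivalence.to T-∧ (Equivalence.from T-≡ (proj₂ (∈-filter⁻ _ {xs = allFin n} w∈)))))

  degInto≤partSize : ∀ v j → degInto P v j ℕ.≤ partSize P j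
  degInto≤partSize v j = Unique-⊆⇒length-≤ (Unique.filter⁺ _ (Unique.allFin⁺ n))
    (λ w∈ → ∈-filter⁺ _ (∈-allFin _) (∈-neighboursIn⁻ w∈))

module _ {k n : ℕ} {F : Graph k} {G : Graph n} (P : FPartition F G) {C : List (Copy F G)}
         (disjoint : AllPairs EdgeDisjoint C)
         (compatible : ∀ c → c ∈ C → ∀ i → part P (emb c i) ≡ i) where

  emb-part : ∀ {c v} → c ∈ C → InCopy c v → emb c (part P v) ≡ v
  emb-part {c} c∈C (i , refl) = cong (emb c) (compatible c c∈C i)

  copiesAt≤degInto : ∀ v j → Edge F (part P v) j → copiesAt C v ℕ.≤ degInto P v j
  copiesAt≤degInto v j e = injection⇒length-≤ (λ c → emb c j) distinctEnds lands
    where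
    through : All (λ c → emb c (part P v) ≡ v) (filter (inCopy? v) C)
    through = All.tabulate λ c∈ → let c∈C , c∋v = ∈-filter⁻ (inCopy? v) {xs = C} c∈ in emb-part c∈C c∋v

    distinctEnds : AllPairs (λ c d → emb c j ≢ emb d j) (filter (inCopy? v) C)
    distinctEnds = allPairs-mapWith-All (λ cv dv c⊥d eq → c⊥d _ j _ j e e (trans cv (≡.sym dv) , eq))
                     through (AllPairsₚ.filter⁺ (inCopy? v) disjoint)

    lands : ∀ {c} → c ∈ filter (inCopy? v) C → emb c j ∈ neighboursIn P v j
    lands {c} c∈ = let c∈C , c∋v = ∈-filter⁻ (inCopy? v) {xs = C} c∈ in
      ∈-neighboursIn⁺ P (subst (λ u → Edge G u (emb c j)) (emb-part c∈C c∋v) (hom c _ j e))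
                        (compatible c c∈C j)

  degInto-≥ : ∀ {ε} → (∀ v → ε * ⟦ n ⟧ ≤ ⟦ copiesAt C v ⟧) →
              ∀ v j → Edge F (part P v) j → ε * ⟦ n ⟧ ≤ ⟦ degInto P v j ⟧
  degInto-≥ covered v j e = ℚ.≤-trans (covered v) (⟦⟧-mono-≤ (copiesAt≤degInto v j e))

  copy⇒partSize-≥ : ∀ {ε} → (∀ v → ε * ⟦ n ⟧ ≤ ⟦ copiesAt C v ⟧) →
                    ∀ {c i j} → c ∈ C → Edge F i j → ε * ⟦ n ⟧ ≤ ⟦ partSize P i ⟧
  copy⇒partSize-≥ {ε} covered {c} {i} {j} c∈C e =
    ℚ.≤-trans (degInto-≥ {ε} covered (emb c j) i e′) (⟦⟧-mono-≤ (degInto≤partSize P (emb c j) i))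
    where
    e′ : Edge F (part P (emb c j)) i
    e′ = subst (λ j → Edge F j i) (≡.sym (compatible c c∈C j)) (Edge-sym F e)

covered⇒copy : ∀ {k n} {F : Graph k} {G : Graph n} {ε} {C : List (Copy F G)} → 0ℚ < ε →
               (∀ v → ε * ⟦ n ⟧ ≤ ⟦ copiesAt C v ⟧) → Fin n → ∃ (_∈ C)
covered⇒copy {C = c ∷ _} _ _ _ = c , here refl
covered⇒copy {n = ℕ.suc n} {ε = ε} {C = []} ε>0 covered v =
  ⊥-elim (ℚ.<-irrefl refl (ℚ.<-≤-trans 0<εn (covered v)))
  where
  0<εn : 0ℚ < ε * ⟦ ℕ.suc n ⟧
  0<εn = subst (_< ε * ⟦ ℕ.suc n ⟧) (ℚ.*-zeroˡ ⟦ ℕ.suc n ⟧)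
           (ℚ.*-monoˡ-<-pos ⟦ ℕ.suc n ⟧ {{ℚ.normalize-pos (ℕ.suc n) 1}} ε>0)

partSize-≥ : ∀ {k n} {F : Graph k} {G : Graph n} (P : FPartition F G) {C : List (Copy F G)} {ε} →
             AllPairs EdgeDisjoint C → (∀ c → c ∈ C → ∀ i → part P (emb c i) ≡ i) → 0ℚ < ε →
             (∀ v → ε * ⟦ n ⟧ ≤ ⟦ copiesAt C v ⟧) →
             ∀ {i j} → Edge F i j → ε * ⟦ n ⟧ ≤ ⟦ partSize P i ⟧
partSize-≥ {n = ℕ.zero} P {ε = ε} _ _ _ _ {i} _ =
  ℚ.≤-trans (ℚ.≤-reflexive (ℚ.*-zeroʳ ε)) (⟦⟧-mono-≤ (ℕ.z≤n {partSize P i}))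
partSize-≥ {n = ℕ.suc _} P {ε = ε} disjoint compatible ε>0 covered e =
  let _ , c∈C = covered⇒copy {ε = ε} ε>0 covered zero in
  copy⇒partSize-≥ P disjoint compatible {ε} covered c∈C e

lemma2p4 : ∀ {k n : ℕ} {{_ : NonZero k}} (F : Graph k) (G : Graph n) (ε : ℚ) → 0ℚ < ε →
  (P : FPartition F G) → UniformlyFarWith F G ε P →
    Far F G (ε * (+ 1 / k))
    × (∀ i j → Edge F i j → ∀ v → part P v ≡ i → ε * ⟦ n ⟧ ≤ ⟦ degInto P v j ⟧)
    × (∀ i → (∃ λ j → Edge F i j) → ε * ⟦ n ⟧ ≤ ⟦ partSize P i ⟧)
lemma2p4 F G ε ε>0 P (C , disjointAt , compatible , covered) =
    edgeDisjoint-cover⇒far {ε = ε} disjoint covered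
  , (λ { _ j e v refl → degInto-≥ P disjoint compatible {ε} covered v j e })
  , (λ { _ (_ , e) → partSize-≥ P {ε = ε} disjoint compatible ε>0 covered e })
  where
  disjoint : AllPairs EdgeDisjoint C
  disjoint = allPairs-lookup⁺ C disjointAt
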